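{- Let $G=(V,E)$ be a finite connected undirected graph with at least two vertices. Let $c\in C(G)$, let $y\in V$ with $d(c,y)=R(G)$, and let $\gamma$ be a shortest path from $c$ to $y$ (so $\gamma$ has length $R(G)$). Then: (i) There exists a vertex $z\neq y$ such that $R(G)-1\le d(c,z)\le R(G)$ and such that for every shortest path $\mu$ from $c$ to $z$, $\gamma\cap\mu=\{c\}$. (ii) More precisely, either there exists a vertex $z$ satisfying all the conditions of (i) together with $d(c,z)=R(G)$, or every vertex $z$ satisfying all the conditions of (i) has $d(c,z)=R(G)-1$ and there exists such a vertex $z_0$ with the property that for every path $\mu$ from $c$ to $z_0$ of length $d(c,z_0)+1$, $\gamma\cap\mu=\{c\}$.
   Context: $d(u,v)$ is the usual graph distance. The eccentricity of $x$ is $r(x)=\max_{v\in V} d(x,v)$; the radius is $R(G)=\min_{x\in V} r(x)$; the center is $C(G)=\{x\in V: r(x)=R(G)\}$. For paths $\gamma,\mu$, $\gamma\cap\mu$ denotes the set of vertices lying on both paths. The length of a path is its number of edges. -}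

module Defs where

open import Data.Nat using (ℕ; zero; suc; _+_; _≤_; _∸_)
open import Data.Fin using (Fin)
open import Data.Bool using (Bool; true; false; T)
open import Data.List using (List; []; _∷_)
open import Data.List.Membership.Propositional using (_∈_)
open import Data.List.Relation.Unary.Unique.Propositional using (Unique)
open import Data.Product using (Σ; ∃; ∃-syntax; _×_; _,_)
open import Data.Sum using (_⊎_)
open import Relation.Binary.PropositionalEquality using (_≡_; _≢_)

record Graph (n : ℕ) : Set where
  field
    adj    : Fin n → Fin n → Bool
    adj-sym : ∀ u v → adj u v ≡ adj v u
    adj-irr : ∀ u → adj u u ≡ false

module _ {n : ℕ} (G : Graph n) where
  open Graph G

  Adj : Fin n → Fin n → Set
  Adj u v = T (adj u v)

  data Walk : Fin n → Fin n → Set where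
    [_]    : ∀ u → Walk u u
    _∷⟨_⟩_ : ∀ u {v w} → Adj u v → Walk v w → Walk u w

  len : ∀ {u v} → Walk u v → ℕ
  len [ u ] = zero
  len (u ∷⟨ _ ⟩ w) = suc (len w)

  verts : ∀ {u v} → Walk u v → List (Fin n)
  verts [ u ] = u ∷ []
  verts (u ∷⟨ _ ⟩ w) = u ∷ verts w

  IsPath : ∀ {u v} → Walk u v → Set
  IsPath w = Unique (verts w)

  Connected : Set
  Connected = ∀ u v → Walk u v

  Dist : Fin n → Fin n → ℕ → Set
  Dist u v k = (Σ (Walk u v) λ w → len w ≡ k) × (∀ (w : Walk u v) → k ≤ len w)

  IsShortestPath : ∀ {u v} → Walk u v → Set
  IsShortestPath {u} {v} μ = IsPath μ × (∀ (w : Walk u v) → len μ ≤ len w)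

  Ecc : Fin n → ℕ → Set
  Ecc x e = (∀ v k → Dist x v k → k ≤ e) × (∃[ v ] Dist x v e)

  Radius : ℕ → Set
  Radius R = (∃[ x ] Ecc x R) × (∀ x e → Ecc x e → R ≤ e)

  InCenter : ℕ → Fin n → Set
  InCenter R x = Radius R × Ecc x R

  MeetOnlyAt : ∀ {c a b} → Fin n → Walk c a → Walk c b → Set
  MeetOnlyAt c γ μ = ∀ x → x ∈ verts γ → x ∈ verts μ → x ≡ c

  CondI : (R : ℕ) (c y : Fin n) → Walk c y → Fin n → ℕ → Set
  CondI R c y γ z k =
    z ≢ y × Dist c z k × R ∸ 1 ≤ k × k ≤ R ×
    (∀ (μ : Walk c z) → IsShortestPath μ → MeetOnlyAt c γ μ)

-- The witness for (i) is a vertex z farthest from the neighbour c'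
-- of c on γ: with e = r(c') ≥ R we get d(c',z) = e, and d(c,z) = k with
-- e - 1 ≤ k ≤ R.  The key estimate (the "detour bound") says that any walk from c
-- to z passing through a vertex of γ other than c has length at least e + 1,
-- because such a walk could be rerouted into a walk c → y or c' → z that is
-- shorter than allowed.  Every c–z walk of length ≤ e therefore meets γ only in c;
-- this covers the shortest ones (length k ≤ R ≤ e) and, when k ≠ R, also the
-- paths of length k + 1 ≤ R ≤ e.  Part (ii) is then a decision: either some
-- vertex satisfies the conditions of (i) at distance R, or none does and all such
-- vertices sit at distance R - 1, with z as the required z₀.
module Submission where

open import Defs
open import Data.Nat using (ℕ; zero; suc; _+_; _≤_; _∸_; z≤n; s≤s; _≤?_)
  renaming (_≟_ to _≟ℕ_)
open import Data.Nat.Properties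
open import Data.Fin using (Fin; punchIn) renaming (_≟_ to _≟F_)
open import Data.Fin.Properties using (any?; punchInᵢ≢i)
open import Data.Bool using (T; T?)
open import Data.List using (allFin)
open import Data.List.Membership.Propositional using (_∈_; find; lose)
open import Data.List.Membership.Propositional.Properties using (∈-allFin)
open import Data.List.Extrema.Nat using (argmax; f[xs]≤f[argmax])
open import Data.List.Relation.Unary.Any as Any using (here; there)
open import Data.List.Relation.Unary.All as All using ()
open import Data.List.Relation.Unary.All.Properties using (¬Any⇒All¬)
open import Data.List.Relation.Unary.AllPairs using ([]; _∷_)
open import Data.Product using (Σ; ∃-syntax; _×_; _,_; proj₁; proj₂)
open import Data.Sum using (_⊎_; inj₁; inj₂)
open import Function using (_∘_)
open import Relation.Nullary using (Dec; yes; no; ¬_; contradiction)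
open import Relation.Nullary.Decidable using (_×-dec_; ¬?; map′)
open import Relation.Binary.PropositionalEquality
  using (_≡_; _≢_; refl; sym; trans; cong; subst)

squeeze-pred : ∀ {R k} → R ∸ 1 ≤ k → k ≤ R → k ≢ R → k ≡ R ∸ 1
squeeze-pred lower upper k≢R = ≤-antisym (<⇒≤pred (≤∧≢⇒< upper k≢R)) lower

other-vertex : ∀ {n} → 2 ≤ n → (x : Fin n) → ∃[ v ] v ≢ x
other-vertex (s≤s (s≤s _)) x = punchIn x Data.Fin.zero , punchInᵢ≢i x _

module _ {n : ℕ} (G : Graph n) where
  open Graph G

  IsMinimal : ∀ {u v} → Walk G u v → Set
  IsMinimal {u} {v} w = ∀ (w' : Walk G u v) → len G w ≤ len G w'

  AvoidsOnGeodesics : ∀ {c y} → Walk G c y → Fin n → Set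
  AvoidsOnGeodesics {c} γ z = ∀ (μ : Walk G c z) → IsShortestPath G μ → MeetOnlyAt G c γ μ

  Adj-sym : ∀ {u v} → Adj G u v → Adj G v u
  Adj-sym {u} {v} = subst T (adj-sym u v)

  _++_ : ∀ {u v w} → Walk G u v → Walk G v w → Walk G u w
  [ _ ] ++ q = q
  (u ∷⟨ a ⟩ p) ++ q = u ∷⟨ a ⟩ (p ++ q)

  len-++ : ∀ {u v w} (p : Walk G u v) (q : Walk G v w) → len G (p ++ q) ≡ len G p + len G q
  len-++ [ _ ] q = refl
  len-++ (u ∷⟨ a ⟩ p) q = cong suc (len-++ p q)

  junction-∈ : ∀ {u v w} (p : Walk G u v) (q : Walk G v w) → v ∈ verts G (p ++ q)
  junction-∈ [ _ ] [ _ ] = here refl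
  junction-∈ [ _ ] (_ ∷⟨ _ ⟩ _) = here refl
  junction-∈ (u ∷⟨ a ⟩ p) q = there (junction-∈ p q)

  split-at : ∀ {u v} (w : Walk G u v) {x} → x ∈ verts G w →
             Σ (Walk G u x) λ p → Σ (Walk G x v) λ q → len G p + len G q ≡ len G w
  split-at [ u ] (here refl) = [ u ] , [ u ] , refl
  split-at (u ∷⟨ a ⟩ w) (here refl) = [ u ] , (u ∷⟨ a ⟩ w) , refl
  split-at (u ∷⟨ a ⟩ w) (there x∈w) with split-at w x∈w
  ... | p , q , eq = (u ∷⟨ a ⟩ p) , q , cong suc eq

  walk-positive : ∀ {u v} (w : Walk G u v) → u ≢ v → 1 ≤ len G w
  walk-positive [ _ ] u≢u = contradiction refl u≢u
  walk-positive (_ ∷⟨ _ ⟩ _) _ = s≤s z≤n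

  -- A minimal walk repeats no vertex: a repetition could be cut out.
  minimal⇒path : ∀ {u v} (w : Walk G u v) → IsMinimal w → IsPath G w
  minimal⇒path [ _ ] _ = All.[] ∷ []
  minimal⇒path (u ∷⟨ a ⟩ w) minimal =
    ¬Any⇒All¬ (verts G w) u∉w ∷ minimal⇒path w (λ w' → ≤-pred (minimal (u ∷⟨ a ⟩ w')))
    where
    u∉w : ¬ u ∈ verts G w
    u∉w u∈w with split-at w u∈w
    ... | p , q , eq = 1+n≰n (≤-trans (minimal q) (subst (len G q ≤_) eq (m≤n+m _ _)))

  minimal⇒shortest : ∀ {u v} (w : Walk G u v) → IsMinimal w → IsShortestPath G w
  minimal⇒shortest w minimal = minimal⇒path w minimal , minimal

  shortest-length : ∀ {u v k} (μ : Walk G u v) → IsShortestPath G μ → Dist G u v k → len G μ ≡ k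
  shortest-length μ (_ , minimal) ((w , refl) , bound) = ≤-antisym (minimal w) (bound _)

  dist-unique : ∀ {u v k k'} → Dist G u v k → Dist G u v k' → k ≡ k'
  dist-unique ((w , refl) , bound) ((w' , refl) , bound') = ≤-antisym (bound w') (bound' w)

  walk≤? : ∀ m u v → Dec (Σ (Walk G u v) λ w → len G w ≤ m)
  walk≤? m u v with u ≟F v
  ... | yes refl = yes ([ u ] , z≤n)
  walk≤? zero u v | no u≢v = no λ { ([ _ ] , _) → u≢v refl ; ((_ ∷⟨ _ ⟩ _) , ()) }
  walk≤? (suc m) u v | no u≢v with any? (λ x → T? (adj u x) ×-dec walk≤? m x v)
  ... | yes (x , a , w , le) = yes ((u ∷⟨ a ⟩ w) , s≤s le)
  ... | no none = no λ { ([ _ ] , _) → u≢v refl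
                       ; ((_ ∷⟨ a ⟩ w) , s≤s le) → none (_ , a , w , le) }

  minimal-walk : ∀ m {u v} (w : Walk G u v) → len G w ≤ m → Σ (Walk G u v) IsMinimal
  minimal-walk zero w le = w , λ _ → ≤-trans le z≤n
  minimal-walk (suc m) {u} {v} w le with walk≤? m u v
  ... | yes (w' , le') = minimal-walk m w' le'
  ... | no none = w , λ w' → ≤-trans le (≰⇒> λ w'≤m → none (w' , w'≤m))

  -- Then a c–z walk μ sharing a
  -- vertex x with γ' has length ≥ e + 1: writing γ' = p·q and μ = s·t at x, the walk
  -- s·q shows 1 + |p| ≤ |s|, and the walk p·t shows e ≤ |p| + |t|.
  detour-bound : ∀ {c c' y z e} (γ' : Walk G c' y) →
                 (∀ (w : Walk G c y) → suc (len G γ') ≤ len G w) →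
                 (∀ (w : Walk G c' z) → e ≤ len G w) →
                 ∀ (μ : Walk G c z) {x} → x ∈ verts G γ' → x ∈ verts G μ → suc e ≤ len G μ
  detour-bound {e = e} γ' γ'-short z-far μ x∈γ' x∈μ
    with split-at γ' x∈γ' | split-at μ x∈μ
  ... | p , q , |p|+|q|≡|γ'| | s , t , |s|+|t|≡|μ| = begin
    suc e                   ≤⟨ s≤s (subst (e ≤_) (len-++ p t) (z-far (p ++ t))) ⟩
    suc (len G p) + len G t ≤⟨ +-monoˡ-≤ (len G t) 1+|p|≤|s| ⟩
    len G s + len G t       ≡⟨ |s|+|t|≡|μ| ⟩
    len G μ                 ∎
    where
    open ≤-Reasoning
    1+|p|≤|s| : suc (len G p) ≤ len G s
    1+|p|≤|s| = +-cancelʳ-≤ (len G q) _ _ (begin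
      suc (len G p + len G q) ≡⟨ cong suc |p|+|q|≡|γ'| ⟩
      suc (len G γ')          ≤⟨ γ'-short (s ++ q) ⟩
      len G (s ++ q)          ≡⟨ len-++ s q ⟩
      len G s + len G q       ∎)

  module Metric (connected : Connected G) where

    geodesic : ∀ u v → Walk G u v
    geodesic u v = proj₁ (minimal-walk _ (connected u v) ≤-refl)

    geodesic-minimal : ∀ u v → IsMinimal (geodesic u v)
    geodesic-minimal u v = proj₂ (minimal-walk _ (connected u v) ≤-refl)

    d : Fin n → Fin n → ℕ
    d u v = len G (geodesic u v)

    d-spec : ∀ {u v} → Dist G u v (d u v)
    d-spec {u} {v} = (geodesic u v , refl) , geodesic-minimal u v

    dist? : ∀ u v k → Dec (Dist G u v k)
    dist? u v k = map′ (λ { refl → d-spec }) (λ dk → dist-unique dk d-spec) (k ≟ℕ d u v)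

    eccentricity : ∀ x → Σ ℕ (Ecc G x)
    eccentricity x = d x far , bounded , far , d-spec
      where
      far : Fin n
      far = argmax (d x) x (allFin n)
      bounded : ∀ v k → Dist G x v k → k ≤ d x far
      bounded v k dk rewrite dist-unique dk d-spec =
        All.lookup (f[xs]≤f[argmax] x (allFin n)) (∈-allFin v)

    ecc-positive : 2 ≤ n → ∀ {x e} → Ecc G x e → 1 ≤ e
    ecc-positive two {x} (bounded , _) with other-vertex two x
    ... | v , v≢x = ≤-trans (walk-positive (geodesic x v) (v≢x ∘ sym)) (bounded v _ d-spec)

    geodesic-through : ∀ {u v x k} → d u x + d x v ≡ k → Dist G u v k →
                       Σ (Walk G u v) λ μ → IsShortestPath G μ × x ∈ verts G μ
    geodesic-through {u} {v} {x} sum≡k (_ , bound) =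
      μ , minimal⇒shortest μ (λ w → subst (_≤ len G w) (sym |μ|≡k) (bound w)) , junction-∈ (geodesic u x) (geodesic x v)
      where
      μ : Walk G u v
      μ = geodesic u x ++ geodesic x v
      |μ|≡k : len G μ ≡ _
      |μ|≡k = trans (len-++ (geodesic u x) (geodesic x v)) sum≡k

    through-geodesic : ∀ {u v x k} {μ : Walk G u v} → Dist G u v k → IsShortestPath G μ →
                       x ∈ verts G μ → d u x + d x v ≡ k
    through-geodesic {u} {v} {x} {μ = μ} dk shortest x∈μ with split-at μ x∈μ
    ... | s , t , |s|+|t|≡|μ| = ≤-antisym
      (subst (_ ≤_) (trans |s|+|t|≡|μ| (shortest-length μ shortest dk))
         (+-mono-≤ (geodesic-minimal u x s) (geodesic-minimal x v t)))
      (subst (_ ≤_) (len-++ (geodesic u x) (geodesic x v))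
         (proj₂ dk (geodesic u x ++ geodesic x v)))

    -- Hence avoiding γ on all shortest paths is decided by checking the
    -- finitely many vertices of γ.
    avoids? : ∀ {c y z k} (γ : Walk G c y) → Dist G c z k → Dec (AvoidsOnGeodesics γ z)
    avoids? {c} {z = z} {k} γ dk
      with Any.any? (λ x → ¬? (x ≟F c) ×-dec (d c x + d x z ≟ℕ k)) (verts G γ)
    ... | yes on-γ with find on-γ
    ...   | x , x∈γ , x≢c , sum≡k with geodesic-through sum≡k dk
    ...     | μ , shortest , x∈μ = no λ avoids → x≢c (avoids μ shortest x x∈γ x∈μ)
    avoids? {c} γ dk | no none = yes avoids
      where
      avoids : AvoidsOnGeodesics γ _
      avoids μ shortest x x∈γ x∈μ with x ≟F c
      ... | yes x≡c = x≡c
      ... | no x≢c = contradiction (lose x∈γ (x≢c , through-geodesic dk shortest x∈μ)) none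

    condI? : ∀ R c y (γ : Walk G c y) z k → Dec (CondI G R c y γ z k)
    condI? R c y γ z k with dist? c z k
    ... | no ¬dk = no (¬dk ∘ proj₁ ∘ proj₂)
    ... | yes dk = map′ (λ { (z≢y , lower , upper , avoids) → z≢y , dk , lower , upper , avoids })
                        (λ { (z≢y , _ , lower , upper , avoids) → z≢y , lower , upper , avoids })
                        (¬? (z ≟F y) ×-dec (R ∸ 1 ≤? k) ×-dec (k ≤? R) ×-dec avoids? γ dk)

    ConclusionII : ∀ R c y → Walk G c y → Set
    ConclusionII R c y γ =
      (∃[ z ] CondI G R c y γ z R)
      ⊎
      ((∀ z k → CondI G R c y γ z k → k ≡ R ∸ 1)
       ×
       (∃[ z₀ ] ∃[ k₀ ] (CondI G R c y γ z₀ k₀ ×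
         (∀ (μ : Walk G c z₀) → IsPath G μ → len G μ ≡ suc k₀ → MeetOnlyAt G c γ μ))))

    -- Part (ii) follows from any witness of (i) that, when it is not at
    -- distance R, also has the stronger property for paths one edge longer:
    -- decide whether some vertex satisfies (i) at distance exactly R.
    conclusion-ii : ∀ {R c y} {γ : Walk G c y} {z k} → CondI G R c y γ z k →
                    (k ≢ R → ∀ (μ : Walk G c z) → IsPath G μ → len G μ ≡ suc k →
                       MeetOnlyAt G c γ μ) →
                    ConclusionII R c y γ
    conclusion-ii {R} {c} {y} {γ} {z} {k} cond long-paths with k ≟ℕ R
    ... | yes refl = inj₁ (z , cond)
    ... | no k≢R with any? (λ z' → condI? R c y γ z' R)
    ...   | yes at-R = inj₁ at-R
    ...   | no none = inj₂ (below-R , z , k , cond , long-paths k≢R)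
      where
      below-R : ∀ z' k' → CondI G R c y γ z' k' → k' ≡ R ∸ 1
      below-R z' k' cond'@(_ , _ , lower , upper , _) =
        squeeze-pred lower upper λ { refl → none (z' , cond') }

    module FarthestFromNeighbour
      {R c c' y} (radius : Radius G R) (c-ecc : Ecc G c R)
      (c~c' : Adj G c c') (γ' : Walk G c' y)
      (γ-minimal : IsMinimal (c ∷⟨ c~c' ⟩ γ')) (γ-length : suc (len G γ') ≡ R) where

      γ : Walk G c y
      γ = c ∷⟨ c~c' ⟩ γ'

      e : ℕ
      e = proj₁ (eccentricity c')

      c'-ecc : Ecc G c' e
      c'-ecc = proj₂ (eccentricity c')

      R≤e : R ≤ e
      R≤e = proj₂ radius c' e c'-ecc

      z : Fin n
      z = proj₁ (proj₂ c'-ecc)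

      z-far : Dist G c' z e
      z-far = proj₂ (proj₂ c'-ecc)

      k : ℕ
      k = d c z

      k≤R : k ≤ R
      k≤R = proj₁ c-ecc z k d-spec

      -- Going through c shows that c' is within k + 1 of z.
      e≤1+k : e ≤ suc k
      e≤1+k = proj₂ z-far (c' ∷⟨ Adj-sym c~c' ⟩ geodesic c z)

      short-walks-avoid : ∀ (μ : Walk G c z) → len G μ ≤ e → MeetOnlyAt G c γ μ
      short-walks-avoid μ short x (here x≡c) x∈μ = x≡c
      short-walks-avoid μ short x (there x∈γ') x∈μ =
        contradiction (≤-trans (detour-bound γ' γ-minimal (proj₂ z-far) μ x∈γ' x∈μ) short) 1+n≰n

      -- d(c',y) ≤ R - 1 < R ≤ e = d(c',z).
      z≢y : z ≢ y
      z≢y refl = 1+n≰n (≤-trans (subst (_≤ e) (sym γ-length) R≤e) (proj₂ z-far γ'))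

      condition : CondI G R c y γ z k
      condition = z≢y , d-spec , ∸-monoˡ-≤ 1 (≤-trans R≤e e≤1+k) , k≤R ,
                  λ μ shortest → short-walks-avoid μ
                    (≤-trans (≤-reflexive (shortest-length μ shortest d-spec)) (≤-trans k≤R R≤e))

      long-paths-avoid : k ≢ R → ∀ (μ : Walk G c z) → IsPath G μ → len G μ ≡ suc k →
                         MeetOnlyAt G c γ μ
      long-paths-avoid k≢R μ _ |μ|≡1+k =
        short-walks-avoid μ (subst (_≤ e) (sym |μ|≡1+k) (≤-trans (≤∧≢⇒< k≤R k≢R) R≤e))

lemma1 : ∀ {n : ℕ} (G : Graph n) → 2 ≤ n → Connected G →
    ∀ (R : ℕ) (c y : Fin n) → InCenter G R c → Dist G c y R →
    (γ : Walk G c y) → IsShortestPath G γ →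
    (∃[ z ] ∃[ k ] CondI G R c y γ z k)
    ×
    ((∃[ z ] CondI G R c y γ z R)
    ⊎
    ((∀ z k → CondI G R c y γ z k → k ≡ R ∸ 1)
    ×
    (∃[ z₀ ] ∃[ k₀ ] (CondI G R c y γ z₀ k₀ ×
    (∀ (μ : Walk G c z₀) → IsPath G μ → len G μ ≡ suc k₀ →
    MeetOnlyAt G c γ μ)))))
lemma1 G two connected R c .c (_ , c-ecc) dy [ _ ] shortest =
  contradiction (subst (1 ≤_) (sym (shortest-length G [ c ] shortest dy)) (ecc-positive two c-ecc))
                1+n≰n
  where open Metric G connected   -- a trivial γ would force R = 0 < r(c)
lemma1 G two connected R c y (radius , c-ecc) dy (_ ∷⟨ c~c' ⟩ γ') shortest =
  (z , k , condition) , conclusion-ii {γ = γ} condition long-paths-avoid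
  where
  open Metric G connected
  open FarthestFromNeighbour radius c-ecc c~c' γ' (proj₂ shortest) (shortest-length G (_ ∷⟨ c~c' ⟩ γ') shortest dy)
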